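{- For all integers $n\ge m\ge 1$, $\mathrm{opt}^{P}_{W}(G_{n,m}) \ge \lceil (m-2)/2\rceil$.
   Context: $G_{n,m}$ is the rectangular grid with $n$ rows and $m$ columns, squares $(i,j)$. A wall is a unit segment separating two adjacent squares (vertical walls separate horizontally adjacent squares, horizontal walls separate vertically adjacent squares); the grid boundary also acts as a wall. A robot starts on $(1,1)$. A move: choose one of the four directions; the robot slides and stops on the last square before it would cross a wall or leave the grid. The robot passes over every square it occupies during a move. A set of walls is a solution of the wall/pass game if every square is passed over during some sequence of moves from $(1,1)$. $\mathrm{opt}^{P}_{W}(G_{n,m})$ is the minimum number of walls in such a solution. -}

module Defs where

open import Data.Nat using (ℕ; zero; suc; _<_)
open import Data.Product using (_×_; _,_; ∃-syntax)
open import Data.List using (List)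
open import Data.List.Membership.Propositional using (_∈_)
open import Relation.Nullary using (¬_)

-- Coordinates are 0-based: square (r , c) with r < n (row), c < m (column);
-- the paper's square (i,j) is (i-1 , j-1); the start (1,1) is (0 , 0).
Pos : Set
Pos = ℕ × ℕ

-- A wall (unit segment between two adjacent squares):
--   vert r c  : vertical wall between (r , c) and (r , c+1)
--   horiz r c : horizontal wall between (r , c) and (r+1 , c)
data Wall : Set where
  vert  : ℕ → ℕ → Wall
  horiz : ℕ → ℕ → Wall

-- A wall of G_{n,m} (interior segment; the boundary is always a wall and is not counted).
data ValidWall (n m : ℕ) : Wall → Set where
  vert-ok  : ∀ {r c} → r < n → suc c < m → ValidWall n m (vert r c)
  horiz-ok : ∀ {r c} → suc r < n → c < m → ValidWall n m (horiz r c)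

data Dir : Set where
  up down left right : Dir

module Game (n m : ℕ) (W : List Wall) where

  data CanStep : Pos → Dir → Pos → Set where
    step-right : ∀ {r c} → suc c < m → ¬ (vert r c ∈ W) →
                 CanStep (r , c) right (r , suc c)
    step-left  : ∀ {r c} → ¬ (vert r c ∈ W) →
                 CanStep (r , suc c) left (r , c)
    step-down  : ∀ {r c} → suc r < n → ¬ (horiz r c ∈ W) →
                 CanStep (r , c) down (suc r , c)
    step-up    : ∀ {r c} → ¬ (horiz r c ∈ W) →
                 CanStep (suc r , c) up (r , c)

  data Slide : Pos → Dir → Pos → Set where
    stop : ∀ {p d} → (∀ q → ¬ CanStep p d q) → Slide p d p
    go   : ∀ {p d q e} → CanStep p d q → Slide q d e → Slide p d e

  data Passes : Pos → Dir → Pos → Set where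
    here  : ∀ {p d} → Passes p d p
    there : ∀ {p d q x} → CanStep p d q → Passes q d x → Passes p d x

  data Reachable : Pos → Set where
    start : Reachable (0 , 0)
    move  : ∀ {p d q} → Reachable p → Slide p d q → Reachable q

  Covered : Pos → Set
  Covered x = ∃[ p ] ∃[ d ] (Reachable p × Passes p d x)

  IsSolution : Set
  IsSolution = ∀ r c → r < n → c < m → Covered (r , c)

IsSolution : (n m : ℕ) → List Wall → Set
IsSolution n m W = Game.IsSolution n m W

module Submission where

-- Call row i (1 ≤ i ≤ n-2) *open* if no wall lies on its upper or
-- lower side, and similarly for an interior column.  A move ends in row i only
-- if it is a vertical move blocked just after row i, or a horizontal move that
-- started in row i; so an open row is never occupied by the robot (the start
-- lies in row 0), and likewise an open column.  A square in an open row and an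
-- open column is then never passed over: a horizontal move over it runs along
-- its row, a vertical one along its column.  Each horizontal wall borders two
-- rows and each vertical wall two columns, so with 2|W| < m-2 some row and some
-- column among the m-2 interior lines 1..m-2 (note m ≤ n) are open.  Hence a
-- solution has m-2 ≤ 2|W|, i.e. ⌈(m-2)/2⌉ ≤ |W|.

open import Defs
open import Data.Nat using (ℕ; _≤_; _∸_; ⌈_/2⌉)
open import Data.List using (List; length)
open import Data.List.Relation.Unary.All using (All)
open import Data.List.Relation.Unary.Unique.Propositional using (Unique)

open import Data.Nat using (zero; suc; _+_; _<_; z≤n; z<s; s<s; s<s⁻¹)
open import Data.Nat.Properties
  using (_≟_; ≤-refl; ≤-<-trans; <-≤-trans; +-suc; +-cancelˡ-≡;
         +-mono-≤; 1+n≢0; ≮⇒≥; <⇒≤; n≡⌈n+n/2⌉; ⌈n/2⌉-mono; module ≤-Reasoning)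
open import Data.Maybe using (Maybe; just; nothing)
open import Data.List using ([]; _∷_; _++_)
open import Data.List.Properties using (length-++; length-removeAt′)
open import Data.List.Relation.Unary.Any using (here; there; index; _─_)
open import Data.List.Membership.Propositional using (_∈_; _∉_)
open import Data.List.Membership.Propositional.Properties using (∈-++⁺ʳ)
open import Data.List.Membership.DecPropositional _≟_ using (_∈?_)
open import Data.Product using (_×_; _,_; ∃-syntax; proj₁; proj₂)
import Data.Product as Product
open import Data.Empty using (⊥-elim)
open import Relation.Nullary using (¬_; yes; no)
open import Relation.Binary.PropositionalEquality
  using (_≡_; _≢_; refl; sym; trans; cong; subst)

∈-─ : ∀ {A : Set} {x y : A} {xs : List A} → x ∈ xs → (y∈xs : y ∈ xs) → x ≢ y → x ∈ (xs ─ y∈xs)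
∈-─ (here refl) (here refl) x≢y = ⊥-elim (x≢y refl)
∈-─ (there x∈xs) (here refl) _ = x∈xs
∈-─ (here refl) (there _) _ = here refl
∈-─ (there x∈xs) (there y∈xs) x≢y = there (∈-─ x∈xs y∈xs x≢y)

-- A list with fewer than t entries misses some value of the interval [a, a+t).
-- If a (written a + 0, the case i = 0) occurs, delete one occurrence and
-- recurse on [a+1, a+t).
missing : ∀ t a (L : List ℕ) → length L < t → ∃[ i ] (i < t × a + i ∉ L)
missing (suc t) a L |L|<1+t with a + 0 ∈? L
... | no a∉L = 0 , z<s , a∉L
... | yes a∈L with missing t (suc a) (L ─ a∈L) shorter
  where
  shorter : length (L ─ a∈L) < t
  shorter = s<s⁻¹ (subst (_< suc t) (length-removeAt′ L (index a∈L)) |L|<1+t)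
...   | i , i<t , a+1+i∉L─a = suc i , s<s i<t , a+[1+i]∉L
  where
  shifted : a + suc i ≡ suc a + i
  shifted = +-suc a i

  a+[1+i]∉L : a + suc i ∉ L
  a+[1+i]∉L a+[1+i]∈L = a+1+i∉L─a (subst (_∈ (L ─ a∈L)) shifted
    (∈-─ a+[1+i]∈L a∈L (λ eq → 1+n≢0 (+-cancelˡ-≡ a (suc i) 0 eq))))

-- The lines bordered by the walls selected by f: a wall w with f w = just a
-- separates line a from line a+1 (rows for horizontal walls, columns for
-- vertical ones).
sides : Maybe ℕ → List ℕ
sides (just a) = a ∷ suc a ∷ []
sides nothing = []

bordered : (Wall → Maybe ℕ) → List Wall → List ℕ
bordered f [] = []
bordered f (w ∷ ws) = sides (f w) ++ bordered f ws

bordered-length : ∀ f W → length (bordered f W) ≤ length W + length W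
bordered-length f [] = z≤n
bordered-length f (w ∷ ws) = begin
  length (sides (f w) ++ bordered f ws)         ≡⟨ length-++ (sides (f w)) ⟩
  length (sides (f w)) + length (bordered f ws) ≤⟨ +-mono-≤ (sides-length (f w)) (bordered-length f ws) ⟩
  2 + (length ws + length ws)                   ≡⟨ cong suc (sym (+-suc (length ws) (length ws))) ⟩
  suc (length ws) + suc (length ws)             ∎
  where
  open ≤-Reasoning
  sides-length : ∀ x → length (sides x) ≤ 2
  sides-length (just _) = ≤-refl
  sides-length nothing = z≤n

bordered-∈ : ∀ f {w a} W → w ∈ W → f w ≡ just a →
             a ∈ bordered f W × suc a ∈ bordered f W
bordered-∈ f (w ∷ ws) (here refl) fw≡a rewrite fw≡a = here refl , there (here refl)
bordered-∈ f (v ∷ ws) (there w∈ws) fw≡a =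
  Product.map (∈-++⁺ʳ (sides (f v))) (∈-++⁺ʳ (sides (f v))) (bordered-∈ f ws w∈ws fw≡a)

horizRow : Wall → Maybe ℕ
horizRow (horiz r _) = just r
horizRow (vert _ _) = nothing

vertCol : Wall → Maybe ℕ
vertCol (vert _ c) = just c
vertCol (horiz _ _) = nothing

-- Row 1+r is open if no horizontal wall lies on its upper or lower side;
-- column 1+c is open if no vertical wall lies on its left or right side.
OpenRow : List Wall → ℕ → Set
OpenRow W r = ∀ c → horiz r c ∉ W × horiz (suc r) c ∉ W

OpenCol : List Wall → ℕ → Set
OpenCol W c = ∀ r → vert r c ∉ W × vert r (suc c) ∉ W

unbordered-row : ∀ W r → suc r ∉ bordered horizRow W → OpenRow W r
unbordered-row W r r∉ c =
  (λ h∈W → r∉ (proj₂ (bordered-∈ horizRow W h∈W refl))) ,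
  (λ h∈W → r∉ (proj₁ (bordered-∈ horizRow W h∈W refl)))

unbordered-col : ∀ W c → suc c ∉ bordered vertCol W → OpenCol W c
unbordered-col W c c∉ r =
  (λ v∈W → c∉ (proj₂ (bordered-∈ vertCol W v∈W refl))) ,
  (λ v∈W → c∉ (proj₁ (bordered-∈ vertCol W v∈W refl)))

module Moves (n m : ℕ) (W : List Wall) where
  open Game n m W

  line : Dir → Pos → ℕ
  line left = proj₁
  line right = proj₁
  line up = proj₂
  line down = proj₂

  step-line : ∀ {p d q} → CanStep p d q → line d p ≡ line d q
  step-line (step-right _ _) = refl
  step-line (step-left _) = refl
  step-line (step-down _ _) = refl
  step-line (step-up _) = refl

  slide-line : ∀ {p d e} → Slide p d e → line d p ≡ line d e
  slide-line (stop _) = refl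
  slide-line (go st sl) = trans (step-line st) (slide-line sl)

  passes-line : ∀ {p d x} → Passes p d x → line d p ≡ line d x
  passes-line here = refl
  passes-line (there st ps) = trans (step-line st) (passes-line ps)

  slide-blocked : ∀ {p d e} → Slide p d e → ∀ q → ¬ CanStep e d q
  slide-blocked (stop blocked) = blocked
  slide-blocked (go _ sl) = slide-blocked sl

  -- An open interior row is never occupied: a horizontal move keeps the row,
  -- and a vertical move could continue past it.
  open-row-unoccupied : ∀ r → suc (suc r) < n → OpenRow W r → ∀ {e} → Reachable e → proj₁ e ≢ suc r
  open-row-unoccupied r _ _ start ()
  open-row-unoccupied r rn isOpen (move {d = left} re sl) eq = open-row-unoccupied r rn isOpen re (trans (slide-line sl) eq)
  open-row-unoccupied r rn isOpen (move {d = right} re sl) eq = open-row-unoccupied r rn isOpen re (trans (slide-line sl) eq)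
  open-row-unoccupied r rn isOpen (move {d = up} {q = _ , c} re sl) refl =
    slide-blocked sl (r , c) (step-up (proj₁ (isOpen c)))
  open-row-unoccupied r rn isOpen (move {d = down} {q = _ , c} re sl) refl =
    slide-blocked sl (suc (suc r) , c) (step-down rn (proj₂ (isOpen c)))

  open-col-unoccupied : ∀ c → suc (suc c) < m → OpenCol W c → ∀ {e} → Reachable e → proj₂ e ≢ suc c
  open-col-unoccupied c _ _ start ()
  open-col-unoccupied c cm isOpen (move {d = up} re sl) eq = open-col-unoccupied c cm isOpen re (trans (slide-line sl) eq)
  open-col-unoccupied c cm isOpen (move {d = down} re sl) eq = open-col-unoccupied c cm isOpen re (trans (slide-line sl) eq)
  open-col-unoccupied c cm isOpen (move {d = left} {q = r , _} re sl) refl =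
    slide-blocked sl (r , c) (step-left (proj₁ (isOpen r)))
  open-col-unoccupied c cm isOpen (move {d = right} {q = r , _} re sl) refl =
    slide-blocked sl (r , suc (suc c)) (step-right cm (proj₂ (isOpen r)))

  open-crossing-uncovered : ∀ r c → suc (suc r) < n → suc (suc c) < m →
    OpenRow W r → OpenCol W c → ¬ Covered (suc r , suc c)
  open-crossing-uncovered r c rn cm orow _ (_ , left , re , ps) = open-row-unoccupied r rn orow re (passes-line ps)
  open-crossing-uncovered r c rn cm orow _ (_ , right , re , ps) = open-row-unoccupied r rn orow re (passes-line ps)
  open-crossing-uncovered r c rn cm _ ocol (_ , up , re , ps) = open-col-unoccupied c cm ocol re (passes-line ps)
  open-crossing-uncovered r c rn cm _ ocol (_ , down , re , ps) = open-col-unoccupied c cm ocol re (passes-line ps)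

⌈/2⌉-≤ : ∀ k w → k ≤ w + w → ⌈ k /2⌉ ≤ w
⌈/2⌉-≤ k w k≤2w = subst (⌈ k /2⌉ ≤_) (sym (n≡⌈n+n/2⌉ w)) (⌈n/2⌉-mono k≤2w)

-- A solution on a grid with 2+k columns and at least as many rows has
-- k ≤ 2|W|: otherwise some interior row and some interior column are open,
-- and the square where they meet is never passed over.
solution-bound : ∀ n k W → 2 + k ≤ n → IsSolution n (2 + k) W → k ≤ length W + length W
solution-bound n k W 2+k≤n sol = ≮⇒≥ too-few-walls
  where
  few : length W + length W < k → ∀ f → length (bordered f W) < k
  few short f = ≤-<-trans (bordered-length f W) short

  too-few-walls : ¬ (length W + length W < k)
  too-few-walls short
    with r , r<k , r∉ ← missing k 1 (bordered horizRow W) (few short horizRow)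
    with c , c<k , c∉ ← missing k 1 (bordered vertCol W) (few short vertCol) =
    Moves.open-crossing-uncovered n (2 + k) W r c rn cm
      (unbordered-row W r r∉) (unbordered-col W c c∉) (sol (suc r) (suc c) (<⇒≤ rn) (<⇒≤ cm))
    where
    rn : suc (suc r) < n
    rn = <-≤-trans (s<s (s<s r<k)) 2+k≤n
    cm : suc (suc c) < 2 + k
    cm = s<s (s<s c<k)

mainTheorem11 : ∀ (n m : ℕ) → 1 ≤ m → m ≤ n →
    (W : List Wall) → All (ValidWall n m) W → Unique W → IsSolution n m W →
    ⌈ (m ∸ 2) /2⌉ ≤ length W
mainTheorem11 n zero _ _ W _ _ _ = z≤n
mainTheorem11 n (suc zero) _ _ W _ _ _ = z≤n
mainTheorem11 n (suc (suc k)) _ m≤n W _ _ sol =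
  ⌈/2⌉-≤ k (length W) (solution-bound n k W m≤n sol)
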